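{- If $G$ is a graph of order $n$ with $\delta_h:=\delta_h(G)\ge 1$, then $$\gamma_{2\mathrm{step}}(G)\le \frac{\ln\delta_h+1}{\delta_h}\,n.$$
   Context: Graphs are finite, simple, undirected. The hop degree of a vertex $i$ is the number of vertices at distance exactly $2$ from $i$; $\delta_h(G)$ is the minimum hop degree over all vertices. A set $S\subseteq V(G)$ is a 2-step dominating set if every vertex of $G$ is at distance exactly $2$ from some vertex of $S$; $\gamma_{2\mathrm{step}}(G)$ is the minimum cardinality of such a set. -}

module Defs where

open import Data.Nat as ℕ using (ℕ; zero; suc; _≤_)
open import Data.Integer as ℤ using (ℤ; +_)
open import Data.Rational as ℚ using (ℚ; _/_)
open import Data.Bool using (Bool; true; false; T; _∧_; not)
open import Data.Fin using (Fin)
open import Data.Fin.Properties using (_≟_)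
open import Data.Fin.Subset using (Subset; _∈_)
open import Data.List using (List; length; filter)
open import Data.Bool.ListAction using (any)
open import Data.Fin.Base using ()
open import Data.Vec.Functional using ()
open import Data.List using (allFin)
open import Data.Product using (∃; _×_)
open import Relation.Nullary.Decidable using (⌊_⌋)
open import Relation.Binary.PropositionalEquality using (_≡_)
open import Relation.Nullary using (¬_)

record Graph (n : ℕ) : Set where
  field
    adj   : Fin n → Fin n → Bool
    sym   : ∀ i j → adj i j ≡ adj j i
    irrefl : ∀ i → adj i i ≡ false
open Graph public

dist2 : ∀ {n} → Graph n → Fin n → Fin n → Bool
dist2 {n} G i j =
  not ⌊ i ≟ j ⌋ ∧ not (adj G i j) ∧ any (λ k → adj G i k ∧ adj G k j) (allFin n)

hopDeg : ∀ {n} → Graph n → Fin n → ℕ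
hopDeg {n} G i = length (filter (λ j → T? (dist2 G i j)) (allFin n))
  where
  open import Data.Bool.Properties using (T?)

IsMinHopDeg : ∀ {n} → Graph n → ℕ → Set
IsMinHopDeg {n} G δ = (∀ i → δ ≤ hopDeg G i) × ∃ λ i → hopDeg G i ≡ δ

TwoStepDominating : ∀ {n} → Graph n → Subset n → Set
TwoStepDominating {n} G S = ∀ v → ∃ λ s → s ∈ S × T (dist2 G s v)

-- a / n as a rational (n = 0 sends to 0; only used with n ≥ 1)
frac : ℤ → ℕ → ℚ
frac a zero = ℚ.0ℚ
frac a (suc m) = a / suc m

expTerm : ℚ → ℕ → ℚ
expTerm x zero = ℚ.1ℚ
expTerm x (suc k) = expTerm x k ℚ.* x ℚ.* ((+ 1) / suc k)

expPartial : ℚ → ℕ → ℚ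
expPartial x zero = ℚ.1ℚ
expPartial x (suc N) = expPartial x N ℚ.+ expTerm x (suc N)

-- "x ≤ ln d" for a natural number d ≥ 1 and rational x:
-- either x ≤ 0 (≤ ln d since d ≥ 1), or exp x ≤ d, with exp x given by its
-- power series (supremum of partial sums, as x ≥ 0 in that case).
LeLn : ℚ → ℕ → Set
LeLn x d = (x ℚ.≤ ℚ.0ℚ) ⊎' (∀ N → expPartial x N ℚ.≤ (+ d / 1))
  where open import Data.Sum renaming (_⊎_ to _⊎'_)

-- Greedy construction. Let c be the number of vertices not yet at distance 2 from the
-- set S built so far. Each of them has at least δ vertices at distance 2, so by double
-- counting some vertex covers at least cδ/n of them, and adding it multiplies c by at
-- most 1 − δ/n ≤ (1 − 1/n)^δ. Greedy steps are taken while cδ ≥ n; afterwards every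
-- remaining vertex gets its own coverer. Since exp(1/n) ≤ n/(n − 1), the bound
-- |S|δ/n − 1 ≤ ln δ follows from the integer inequality (n/(n − 1))^p ≤ δ for
-- p = |S|δ − n, and the partial sums of exp(p/n) are bounded by those of the series
-- (1 − 1/n)^(−p) = ∑ₖ multichoose p k · n^(−k).
module Submission where

open import Data.Bool.Base using (Bool; true; false; T; not; _∧_)
open import Data.Bool.ListAction using (or)
open import Data.Bool.Properties using (T?; T-≡; ∧-comm)
open import Data.Empty using (⊥-elim)
open import Data.Fin.Base using (Fin; zero; suc)
open import Data.Fin.Properties as Fin using (any?; all?; ¬∀⟶∃¬)
open import Data.Fin.Subset using (Subset; _∈_; _∪_; ⁅_⁆; ⊥; ∣_∣; inside; outside)
open import Data.Fin.Subset.Properties using (_∈?_; x∈⁅x⁆; p⊆p∪q; q⊆p∪q; ∉⊥; ∣⊥∣≡0; ∪-identityʳ)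
open import Data.Integer.Base as ℤ using (+_; _-_)
import Data.Integer.Properties as ℤ
open import Data.List.Base using (length; filter; tabulate; allFin)
open import Data.List.Properties using (map-cong)
open import Data.Nat.Base
open import Data.Nat.Induction using (<-wellFounded)
open import Data.Nat.Properties
open import Data.Nat.Tactic.RingSolver using (solve-∀)
open import Data.Product.Base using (Σ; ∃; _×_; _,_)
open import Data.Rational.Base as ℚ using (toℚᵘ)
import Data.Rational.Properties as ℚ
open import Data.Rational.Unnormalised.Base as ℚᵘ using (*≤*; *≡*)
import Data.Rational.Unnormalised.Properties as ℚᵘ
open import Data.Sum.Base using (_⊎_; inj₁; inj₂)
open import Data.Unit.Base using (tt)
open import Data.Vec.Base using (_∷_)
open import Function.Base using (_∘_)
open import Function.Bundles using (Equivalence)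
open import Induction.WellFounded using (Acc; acc)
open import Relation.Binary.PropositionalEquality
open import Relation.Nullary using (Dec; yes; no; does; ¬_; _×-dec_)
open import Relation.Nullary.Decidable using (⌊_⌋; dec-true; dec-false)
open import Defs using (Graph; adj; dist2; hopDeg; IsMinHopDeg; TwoStepDominating; LeLn; frac; expTerm; expPartial)

import Algebra.Properties.CommutativeMonoid.Sum as CommutativeMonoidSum
import Algebra.Properties.CommutativeSemigroup as CommutativeSemigroupProperties
import Algebra.Properties.Semiring.Sum as SemiringSum

open CommutativeMonoidSum +-0-commutativeMonoid using (sum; sum-syntax; ∑-comm; ∑-distrib-+; sum-cong-≗)
open CommutativeSemigroupProperties *-commutativeSemigroup
  using (xy∙z≈y∙xz; xy∙z≈xz∙y; xy∙z≈x∙zy; x∙yz≈y∙xz; x∙yz≈y∙zx; x∙yz≈yx∙z; interchange)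
open SemiringSum +-*-semiring using (*-distribʳ-sum)

-- ((m + 1)/m)^p ≤ δ; since exp(1/(m + 1)) ≤ (m + 1)/m, it implies p/(m + 1) ≤ ln δ.
RatioPow≤ : ℕ → ℕ → ℕ → Set
RatioPow≤ m p δ = suc m ^ p ≤ δ * m ^ p

RatioPow≤-antitone : ∀ {m δ p q} .{{_ : NonZero m}} → p ≤ q → RatioPow≤ m q δ → RatioPow≤ m p δ
RatioPow≤-antitone {m} {δ} {p} p≤q h with m≤n⇒∃[o]m+o≡n p≤q
... | k , refl = *-cancelʳ-≤ _ _ (m ^ k) {{m^n≢0 m k}} (begin
  suc m ^ p * m ^ k      ≤⟨ *-monoʳ-≤ (suc m ^ p) (^-monoˡ-≤ k (n≤1+n m)) ⟩
  suc m ^ p * suc m ^ k  ≡⟨ ^-distribˡ-+-* (suc m) p k ⟨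
  suc m ^ (p + k)        ≤⟨ h ⟩
  δ * m ^ (p + k)        ≡⟨ cong (δ *_) (^-distribˡ-+-* m p k) ⟩
  δ * (m ^ p * m ^ k)    ≡⟨ *-assoc δ (m ^ p) (m ^ k) ⟨
  δ * m ^ p * m ^ k      ∎)
  where open ≤-Reasoning

bernoulli : ∀ m w r → w + r ≡ suc m → suc m ^ w * r ≤ suc m * m ^ w
bernoulli m zero    r refl = ≤-reflexive (*-comm 1 (suc m))
bernoulli m (suc w) r w+r≡n = begin
  suc m * suc m ^ w * r    ≡⟨ xy∙z≈y∙xz (suc m) (suc m ^ w) r ⟩
  suc m ^ w * (suc m * r)  ≤⟨ *-monoʳ-≤ (suc m ^ w) n*r≤[1+r]*m ⟩
  suc m ^ w * (suc r * m)  ≡⟨ *-assoc (suc m ^ w) (suc r) m ⟨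
  suc m ^ w * suc r * m    ≤⟨ *-monoˡ-≤ m (bernoulli m w (suc r) (trans (+-suc w r) w+r≡n)) ⟩
  suc m * m ^ w * m        ≡⟨ xy∙z≈xz∙y (suc m) (m ^ w) m ⟩
  suc m * m * m ^ w        ≡⟨ *-assoc (suc m) m (m ^ w) ⟩
  suc m * (m * m ^ w)      ∎
  where
  open ≤-Reasoning
  r≤m : r ≤ m
  r≤m = subst (r ≤_) (suc-injective w+r≡n) (m≤n+m r w)
  n*r≤[1+r]*m : suc m * r ≤ suc r * m
  n*r≤[1+r]*m = begin
    r + m * r  ≤⟨ +-monoˡ-≤ (m * r) r≤m ⟩
    m + m * r  ≡⟨ cong (_+_ m) (*-comm m r) ⟩
    m + r * m  ∎

Decayed : ℕ → ℕ → ℕ → ℕ → Set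
Decayed m δ j c = suc m ^ (j * δ) * c ≤ suc m * m ^ (j * δ)

Decayed-initial : ∀ m δ → Decayed m δ 0 (suc m)
Decayed-initial m δ = ≤-reflexive (*-comm 1 (suc m))

Shrinks : ℕ → ℕ → ℕ → ℕ → Set
Shrinks n δ c c′ = c′ * n + c * δ ≤ c * n

Shrinks⇒≤complement : ∀ {n δ e c c′} → δ + e ≡ n → Shrinks n δ c c′ → c′ * n ≤ c * e
Shrinks⇒≤complement {δ = δ} {e} {c} {c′} refl shrink = +-cancelʳ-≤ (c * δ) (c′ * (δ + e)) (c * e) (begin
  c′ * (δ + e) + c * δ  ≤⟨ shrink ⟩
  c * (δ + e)           ≡⟨ *-distribˡ-+ c δ e ⟩
  c * δ + c * e         ≡⟨ +-comm (c * δ) (c * e) ⟩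
  c * e + c * δ         ∎)
  where open ≤-Reasoning

Shrinks⇒< : ∀ {n δ c c′} → 0 < c * δ → Shrinks n δ c c′ → c′ < c
Shrinks⇒< {n} {δ} {c} {c′} 0<cδ shrink = *-cancelʳ-< n c′ c (begin-strict
  c′ * n          <⟨ m<m+n (c′ * n) 0<cδ ⟩
  c′ * n + c * δ  ≤⟨ shrink ⟩
  c * n           ∎)
  where open ≤-Reasoning

-- One greedy step multiplies the count by at most 1 − δ/n ≤ (1 − 1/n)^δ.
Decayed-step : ∀ {m δ j c c′} → δ ≤ suc m → Decayed m δ j c →
               Shrinks (suc m) δ c c′ → Decayed m δ (suc j) c′
Decayed-step {m} {δ} {j} {c} {c′} δ≤n decayed shrink with m≤n⇒∃[o]m+o≡n δ≤n
... | e , δ+e≡n = begin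
  n ^ (δ + j * δ) * c′      ≡⟨ cong (_* c′) (^-distribˡ-+-* n δ (j * δ)) ⟩
  n ^ δ * n ^ (j * δ) * c′  ≡⟨ xy∙z≈y∙xz (n ^ δ) (n ^ (j * δ)) c′ ⟩
  n ^ (j * δ) * (n ^ δ * c′) ≤⟨ *-monoʳ-≤ (n ^ (j * δ)) one-step ⟩
  n ^ (j * δ) * (c * m ^ δ)  ≡⟨ *-assoc (n ^ (j * δ)) c (m ^ δ) ⟨
  n ^ (j * δ) * c * m ^ δ    ≤⟨ *-monoˡ-≤ (m ^ δ) decayed ⟩
  n * m ^ (j * δ) * m ^ δ    ≡⟨ xy∙z≈x∙zy n (m ^ (j * δ)) (m ^ δ) ⟩
  n * (m ^ δ * m ^ (j * δ))  ≡⟨ cong (n *_) (^-distribˡ-+-* m δ (j * δ)) ⟨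
  n * m ^ (δ + j * δ)        ∎
  where
  open ≤-Reasoning
  n = suc m
  one-step : n ^ δ * c′ ≤ c * m ^ δ
  one-step = *-cancelˡ-≤ n (begin
    n * (n ^ δ * c′)  ≡⟨ x∙yz≈y∙zx n (n ^ δ) c′ ⟩
    n ^ δ * (c′ * n)  ≤⟨ *-monoʳ-≤ (n ^ δ) (Shrinks⇒≤complement {c = c} {c′} δ+e≡n shrink) ⟩
    n ^ δ * (c * e)   ≡⟨ x∙yz≈y∙xz (n ^ δ) c e ⟩
    c * (n ^ δ * e)   ≤⟨ *-monoʳ-≤ c (bernoulli m δ e δ+e≡n) ⟩
    c * (n * m ^ δ)   ≡⟨ x∙yz≈y∙xz c n (m ^ δ) ⟩
    n * (c * m ^ δ)   ∎)

Decayed⇒RatioPow≤ : ∀ {m δ j c} → Decayed m δ j c → suc m ≤ c * δ → RatioPow≤ m (j * δ) δ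
Decayed⇒RatioPow≤ {m} {δ} {j} {c} decayed n≤cδ = *-cancelˡ-≤ (suc m) (begin
  suc m * suc m ^ (j * δ)    ≡⟨ *-comm (suc m) (suc m ^ (j * δ)) ⟩
  suc m ^ (j * δ) * suc m    ≤⟨ *-monoʳ-≤ (suc m ^ (j * δ)) n≤cδ ⟩
  suc m ^ (j * δ) * (c * δ)  ≡⟨ *-assoc (suc m ^ (j * δ)) c δ ⟨
  suc m ^ (j * δ) * c * δ    ≤⟨ *-monoˡ-≤ δ decayed ⟩
  suc m * m ^ (j * δ) * δ    ≡⟨ xy∙z≈x∙zy (suc m) (m ^ (j * δ)) δ ⟩
  suc m * (δ * m ^ (j * δ))  ∎)
  where open ≤-Reasoning

-- With δ = w + t and n = δ + e, the hypotheses say c′ ≤ c e/n and c′δ = e + w; the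
-- slack (e + w)(t + e) − n e = w t is what makes n² ≤ c δ (t + e).
overshoot-square : ∀ {n δ c c′ w t e} .{{_ : NonZero e}} → w + t ≡ δ → δ + e ≡ n →
                   c′ * n ≤ c * e → c′ * δ ≡ e + w → n * n ≤ c * δ * (t + e)
overshoot-square {c = c} {c′} {w} {t} {e} refl refl c′n≤ce c′δ≡e+w = *-cancelʳ-≤ _ _ e (begin
  n * n * e              ≡⟨ *-assoc n n e ⟩
  n * (n * e)            ≤⟨ *-monoʳ-≤ n (m≤m+n (n * e) (w * t)) ⟩
  n * (n * e + w * t)    ≡⟨ cong (n *_) (slack w t e) ⟩
  n * ((e + w) * r)      ≡⟨ cong (λ x → n * (x * r)) c′δ≡e+w ⟨
  n * (c′ * δ * r)       ≡⟨ swap₁ n c′ δ r ⟩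
  c′ * n * δ * r         ≤⟨ *-monoˡ-≤ r (*-monoˡ-≤ δ c′n≤ce) ⟩
  c * e * δ * r          ≡⟨ swap₂ c e δ r ⟩
  c * δ * r * e          ∎)
  where
  open ≤-Reasoning
  δ = w + t
  n = w + t + e
  r = t + e
  slack : ∀ w t e → (w + t + e) * e + w * t ≡ (e + w) * (t + e)
  slack = solve-∀
  swap₁ : ∀ n c′ δ r → n * (c′ * δ * r) ≡ c′ * n * δ * r
  swap₁ = solve-∀
  swap₂ : ∀ c e δ r → c * e * δ * r ≡ c * δ * r * e
  swap₂ = solve-∀

overshoot≤ : ∀ {n δ x w} → x < n → n + w ≡ δ + x → w ≤ δ
overshoot≤ {n} {δ} {x} {w} x<n n+w≡δ+x = +-cancelˡ-≤ n w δ (begin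
  n + w  ≡⟨ n+w≡δ+x ⟩
  δ + x  ≤⟨ +-monoʳ-≤ δ (<⇒≤ x<n) ⟩
  δ + n  ≡⟨ +-comm δ n ⟩
  n + δ  ∎)
  where open ≤-Reasoning

-- (n/m)^(jδ + w) ≤ (n/c) · (n/(t + e)) ≤ δ, by Decayed, bernoulli and overshoot-square.
RatioPow≤-overshoot : ∀ {m δ j c c′ w} .{{_ : NonZero m}} → δ ≤ m → Decayed m δ j c →
                      Shrinks (suc m) δ c c′ → c′ * δ < suc m →
                      suc m + w ≡ δ + c′ * δ → RatioPow≤ m (j * δ + w) δ
RatioPow≤-overshoot {m} {δ} {j} {c} {c′} {w} δ≤m decayed shrink c′δ<n n+w≡δ+c′δ
  with m≤n⇒∃[o]m+o≡n (overshoot≤ c′δ<n n+w≡δ+c′δ) | m≤n⇒∃[o]m+o≡n (m≤n⇒m≤1+n δ≤m)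
... | t , w+t≡δ | e , δ+e≡n = *-cancelʳ-≤ _ _ (c * r) {{cr≢0}} (begin
  n ^ (a + w) * (c * r)          ≡⟨ cong (_* (c * r)) (^-distribˡ-+-* n a w) ⟩
  n ^ a * n ^ w * (c * r)        ≡⟨ interchange (n ^ a) (n ^ w) c r ⟩
  n ^ a * c * (n ^ w * r)        ≤⟨ *-mono-≤ decayed (bernoulli m w r w+r≡n) ⟩
  n * m ^ a * (n * m ^ w)        ≡⟨ interchange n (m ^ a) n (m ^ w) ⟩
  n * n * (m ^ a * m ^ w)        ≤⟨ *-monoˡ-≤ (m ^ a * m ^ w) n²≤cδr ⟩
  c * δ * r * (m ^ a * m ^ w)    ≡⟨ regroup c δ r (m ^ a * m ^ w) ⟩
  δ * (m ^ a * m ^ w) * (c * r)  ≡⟨ cong (λ x → δ * x * (c * r)) (^-distribˡ-+-* m a w) ⟨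
  δ * m ^ (a + w) * (c * r)      ∎)
  where
  open ≤-Reasoning
  n = suc m
  a = j * δ
  r = t + e
  w+r≡n : w + r ≡ n
  w+r≡n = trans (sym (+-assoc w t e)) (trans (cong (_+ e) w+t≡δ) δ+e≡n)
  c′δ≡e+w : c′ * δ ≡ e + w
  c′δ≡e+w = +-cancelˡ-≡ δ (c′ * δ) (e + w) (begin-equality
    δ + c′ * δ  ≡⟨ n+w≡δ+c′δ ⟨
    n + w       ≡⟨ cong (_+ w) δ+e≡n ⟨
    δ + e + w   ≡⟨ +-assoc δ e w ⟩
    δ + (e + w) ∎)
  instance
    e≢0 : NonZero e
    e≢0 = ≢-nonZero λ { refl → 1+n≰n (subst (_≤ m) (trans (sym (+-identityʳ δ)) δ+e≡n) δ≤m) }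
  n²≤cδr : n * n ≤ c * δ * r
  n²≤cδr = overshoot-square {c = c} {c′} w+t≡δ δ+e≡n (Shrinks⇒≤complement {c = c} {c′} δ+e≡n shrink) c′δ≡e+w
  cδr≢0 : NonZero (c * δ * r)
  cδr≢0 = >-nonZero (≤-trans (s≤s z≤n) n²≤cδr)
  cr≢0 : NonZero (c * r)
  cr≢0 = m*n≢0 c r {{m*n≢0⇒m≢0 c {{m*n≢0⇒m≢0 (c * δ) {{cδr≢0}}}}}} {{m*n≢0⇒n≢0 (c * δ) {{cδr≢0}}}}
  regroup : ∀ c δ r x → c * δ * r * x ≡ δ * x * (c * r)
  regroup = solve-∀

-- Integer form of s δ/n − 1 ≤ ln δ, for n = m + 1.
SizeBound : ℕ → ℕ → ℕ → Set
SizeBound m δ s = s * δ ≤ suc m ⊎ ∃ λ p → s * δ ≡ suc m + p × RatioPow≤ m p δ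

SizeBound-at-stop : ∀ {m δ j c c′ s} .{{_ : NonZero m}} → δ ≤ m → Decayed m δ j c →
                    suc m ≤ c * δ → c′ * δ < suc m → Shrinks (suc m) δ c c′ →
                    s ≤ suc j + c′ → SizeBound m δ s
SizeBound-at-stop {m} {δ} {j} {c} {c′} {s} δ≤m decayed n≤cδ c′δ<n shrink s≤1+j+c′
  with s * δ ≤? suc m
... | yes sδ≤n = inj₁ sδ≤n
... | no sδ≰n with m≤n⇒∃[o]m+o≡n (<⇒≤ (≰⇒> sδ≰n))
...   | p , n+p≡sδ = inj₂ (p , sym n+p≡sδ , bound (δ + c′ * δ ≤? n))
  where
  open ≤-Reasoning
  n = suc m
  p+n≤ : p + n ≤ j * δ + (δ + c′ * δ)
  p+n≤ = begin
    p + n                 ≡⟨ +-comm p n ⟩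
    n + p                 ≡⟨ n+p≡sδ ⟩
    s * δ                 ≤⟨ *-monoˡ-≤ δ s≤1+j+c′ ⟩
    (suc j + c′) * δ      ≡⟨ expand j c′ δ ⟩
    j * δ + (δ + c′ * δ)  ∎
    where
    expand : ∀ j c′ δ → (suc j + c′) * δ ≡ j * δ + (δ + c′ * δ)
    expand = solve-∀
  bound : Dec (δ + c′ * δ ≤ n) → RatioPow≤ m p δ
  bound (yes ≤n) = RatioPow≤-antitone {δ = δ} p≤jδ (Decayed⇒RatioPow≤ {δ = δ} {j} decayed n≤cδ)
    where
    p≤jδ : p ≤ j * δ
    p≤jδ = +-cancelʳ-≤ n p (j * δ) (≤-trans p+n≤ (+-monoʳ-≤ (j * δ) ≤n))
  bound (no ≰n) with m≤n⇒∃[o]m+o≡n (<⇒≤ (≰⇒> ≰n))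
  ... | w , n+w≡δ+c′δ =
    RatioPow≤-antitone {δ = δ} p≤jδ+w (RatioPow≤-overshoot {δ = δ} {j} {c} {c′} δ≤m decayed shrink c′δ<n n+w≡δ+c′δ)
    where
    p≤jδ+w : p ≤ j * δ + w
    p≤jδ+w = +-cancelʳ-≤ n p (j * δ + w) (begin
      p + n                 ≤⟨ p+n≤ ⟩
      j * δ + (δ + c′ * δ)  ≡⟨ cong (_+_ (j * δ)) n+w≡δ+c′δ ⟨
      j * δ + (n + w)       ≡⟨ cong (_+_ (j * δ)) (+-comm n w) ⟩
      j * δ + (w + n)       ≡⟨ +-assoc (j * δ) w n ⟨
      j * δ + w + n         ∎)

risingFactorial : ℕ → ℕ → ℕ
risingFactorial p zero    = 1
risingFactorial p (suc k) = risingFactorial p k * (p + k)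

-- multichoose p k = (p + k − 1 choose k), the coefficient of x^k in (1 − x)^(−p).
multichoose : ℕ → ℕ → ℕ
multichoose p       zero    = 1
multichoose zero    (suc k) = 0
multichoose (suc p) (suc k) = multichoose p (suc k) + multichoose (suc p) k

risingFactorial-shift : ∀ p k → risingFactorial (suc p) k * p ≡ risingFactorial p k * (p + k)
risingFactorial-shift p zero    = cong (1 *_) (sym (+-identityʳ p))
risingFactorial-shift p (suc k) = begin
  risingFactorial (suc p) k * (suc p + k) * p  ≡⟨ xy∙z≈xz∙y (risingFactorial (suc p) k) (suc p + k) p ⟩
  risingFactorial (suc p) k * p * (suc p + k)  ≡⟨ cong₂ _*_ (risingFactorial-shift p k) (sym (+-suc p k)) ⟩
  risingFactorial p k * (p + k) * (p + suc k)  ∎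
  where open ≡-Reasoning

risingFactorial-pascal : ∀ p k → risingFactorial (suc p) (suc k) ≡
                         risingFactorial p (suc k) + suc k * risingFactorial (suc p) k
risingFactorial-pascal p k = begin
  risingFactorial (suc p) k * (suc p + k)                ≡⟨ cong (risingFactorial (suc p) k *_) (sym (+-suc p k)) ⟩
  risingFactorial (suc p) k * (p + suc k)                ≡⟨ split (risingFactorial (suc p) k) p (suc k) ⟩
  risingFactorial (suc p) k * p + suc k * risingFactorial (suc p) k
                                                         ≡⟨ cong (_+ suc k * risingFactorial (suc p) k) (risingFactorial-shift p k) ⟩
  risingFactorial p (suc k) + suc k * risingFactorial (suc p) k ∎
  where
  open ≡-Reasoning
  split : ∀ a b c → a * (b + c) ≡ a * b + c * a
  split = solve-∀

risingFactorial-zero : ∀ k → risingFactorial 0 (suc k) ≡ 0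
risingFactorial-zero zero    = refl
risingFactorial-zero (suc k) = cong (_* suc k) (risingFactorial-zero k)

!*multichoose≡risingFactorial : ∀ p k → k ! * multichoose p k ≡ risingFactorial p k
!*multichoose≡risingFactorial p       zero    = refl
!*multichoose≡risingFactorial zero    (suc k) = trans (*-zeroʳ (suc k !)) (sym (risingFactorial-zero k))
!*multichoose≡risingFactorial (suc p) (suc k) = begin
  suc k ! * (multichoose p (suc k) + multichoose (suc p) k)
    ≡⟨ split (suc k) (k !) (multichoose p (suc k)) (multichoose (suc p) k) ⟩
  suc k ! * multichoose p (suc k) + suc k * (k ! * multichoose (suc p) k)
    ≡⟨ cong₂ (λ x y → x + suc k * y) (!*multichoose≡risingFactorial p (suc k)) (!*multichoose≡risingFactorial (suc p) k) ⟩
  risingFactorial p (suc k) + suc k * risingFactorial (suc p) k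
    ≡⟨ risingFactorial-pascal p k ⟨
  risingFactorial (suc p) (suc k) ∎
  where
  open ≡-Reasoning
  split : ∀ a f b c → a * f * (b + c) ≡ a * f * b + a * (f * c)
  split = solve-∀

^≤risingFactorial : ∀ p k → p ^ k ≤ risingFactorial p k
^≤risingFactorial p zero    = ≤-refl
^≤risingFactorial p (suc k) = begin
  p * p ^ k                ≡⟨ *-comm p (p ^ k) ⟩
  p ^ k * p                ≤⟨ *-mono-≤ (^≤risingFactorial p k) (m≤m+n p k) ⟩
  risingFactorial p k * (p + k) ∎
  where open ≤-Reasoning

^≤!*multichoose : ∀ p k → p ^ k ≤ k ! * multichoose p k
^≤!*multichoose p k = subst (p ^ k ≤_) (sym (!*multichoose≡risingFactorial p k)) (^≤risingFactorial p k)

-- n^N ∑_{k ≤ N} multichoose p k / n^k: a partial sum of the series of (1 − 1/n)^(−p), scaled by n^N.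
multichooseSeries : ℕ → ℕ → ℕ → ℕ
multichooseSeries n p zero    = 1
multichooseSeries n p (suc N) = n * multichooseSeries n p N + multichoose p (suc N)

multichooseSeries-zero : ∀ n N → multichooseSeries n 0 N ≡ n ^ N
multichooseSeries-zero n zero    = refl
multichooseSeries-zero n (suc N) =
  trans (+-identityʳ (n * multichooseSeries n 0 N)) (cong (n *_) (multichooseSeries-zero n N))

multichooseSeries-pascal : ∀ m p N → multichooseSeries (suc m) (suc p) N * m + multichoose (suc p) N ≡
                           suc m * multichooseSeries (suc m) p N
multichooseSeries-pascal m p zero    = base m
  where
  base : ∀ m → 1 * m + 1 ≡ suc m * 1
  base = solve-∀
multichooseSeries-pascal m p (suc N) = begin
  (n * A + C) * m + C                   ≡⟨ spread m A C ⟩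
  n * (A * m) + n * C                   ≡⟨ regroup n (A * m) (multichoose p (suc N)) (multichoose (suc p) N) ⟩
  n * ((A * m + multichoose (suc p) N) + multichoose p (suc N))
    ≡⟨ cong (λ x → n * (x + multichoose p (suc N))) (multichooseSeries-pascal m p N) ⟩
  n * (n * multichooseSeries n p N + multichoose p (suc N)) ∎
  where
  open ≡-Reasoning
  n = suc m
  A = multichooseSeries n (suc p) N
  C = multichoose (suc p) (suc N)
  spread : ∀ m A C → (suc m * A + C) * m + C ≡ suc m * (A * m) + suc m * C
  spread = solve-∀
  regroup : ∀ n x y z → n * x + n * (y + z) ≡ n * ((x + z) + y)
  regroup = solve-∀

multichooseSeries-bound : ∀ m p N → multichooseSeries (suc m) p N * m ^ p ≤ suc m ^ N * suc m ^ p
multichooseSeries-bound m zero    N = ≤-reflexive (cong (_* 1) (multichooseSeries-zero (suc m) N))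
multichooseSeries-bound m (suc p) N = begin
  A * (m * m ^ p)                          ≡⟨ *-assoc A m (m ^ p) ⟨
  A * m * m ^ p                            ≤⟨ *-monoˡ-≤ (m ^ p) Am≤nS ⟩
  suc m * S * m ^ p                        ≡⟨ *-assoc (suc m) S (m ^ p) ⟩
  suc m * (S * m ^ p)                      ≤⟨ *-monoʳ-≤ (suc m) (multichooseSeries-bound m p N) ⟩
  suc m * (suc m ^ N * suc m ^ p)          ≡⟨ x∙yz≈y∙xz (suc m) (suc m ^ N) (suc m ^ p) ⟩
  suc m ^ N * (suc m * suc m ^ p)          ∎
  where
  open ≤-Reasoning
  A = multichooseSeries (suc m) (suc p) N
  S = multichooseSeries (suc m) p N
  Am≤nS : A * m ≤ suc m * S
  Am≤nS = subst (A * m ≤_) (multichooseSeries-pascal m p N) (m≤m+n (A * m) _)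

multichooseSeries≤δ*^ : ∀ {m δ p} .{{_ : NonZero m}} → RatioPow≤ m p δ → ∀ N →
                        multichooseSeries (suc m) p N ≤ δ * suc m ^ N
multichooseSeries≤δ*^ {m} {δ} {p} ratio N = *-cancelʳ-≤ S (δ * n ^ N) (m ^ p) {{m^n≢0 m p}} (begin
  S * m ^ p            ≤⟨ multichooseSeries-bound m p N ⟩
  n ^ N * n ^ p        ≤⟨ *-monoʳ-≤ (n ^ N) ratio ⟩
  n ^ N * (δ * m ^ p)  ≡⟨ x∙yz≈yx∙z (n ^ N) δ (m ^ p) ⟩
  δ * n ^ N * m ^ p    ∎)
  where
  open ≤-Reasoning
  n = suc m
  S = multichooseSeries n p N

indicator : Bool → ℕ
indicator true  = 1
indicator false = 0

indicator≤1 : ∀ b → indicator b ≤ 1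
indicator≤1 true  = ≤-refl
indicator≤1 false = z≤n

sum-mono-≤ : ∀ {n} {f g : Fin n → ℕ} → (∀ i → f i ≤ g i) → sum f ≤ sum g
sum-mono-≤ {zero}  f≤g = z≤n
sum-mono-≤ {suc n} f≤g = +-mono-≤ (f≤g zero) (sum-mono-≤ (f≤g ∘ suc))

term≤sum : ∀ {n} (f : Fin n → ℕ) i → f i ≤ sum f
term≤sum f zero    = m≤m+n (f zero) _
term≤sum f (suc i) = ≤-trans (term≤sum (f ∘ suc) i) (m≤n+m _ (f zero))

∑1≡n : ∀ n → ∑[ i < n ] 1 ≡ n
∑1≡n zero    = refl
∑1≡n (suc n) = cong suc (∑1≡n n)

∑indicator≤n : ∀ {n} (b : Fin n → Bool) → ∑[ i < n ] indicator (b i) ≤ n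
∑indicator≤n {n} b = subst (∑[ i < n ] indicator (b i) ≤_) (∑1≡n n) (sum-mono-≤ (indicator≤1 ∘ b))

∑indicator<n : ∀ {n} (b : Fin n → Bool) i → b i ≡ false → ∑[ j < n ] indicator (b j) < n
∑indicator<n {suc n} b zero    bᵢ≡false rewrite bᵢ≡false = s≤s (∑indicator≤n (b ∘ suc))
∑indicator<n {suc n} b (suc i) bᵢ≡false = begin-strict
  indicator (b zero) + ∑[ j < n ] indicator (b (suc j))  <⟨ +-mono-≤-< (indicator≤1 (b zero)) (∑indicator<n (b ∘ suc) i bᵢ≡false) ⟩
  1 + n                                                    ∎
  where open ≤-Reasoning

∑indicator-witness : ∀ {n} (b : Fin n → Bool) → 0 < ∑[ i < n ] indicator (b i) → ∃ λ i → T (b i)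
∑indicator-witness {suc n} b 0<∑ with b zero in b₀
... | true  = zero , subst T (sym b₀) tt
... | false with ∑indicator-witness (b ∘ suc) 0<∑
...   | i , bᵢ = suc i , bᵢ

sum≤n*term : ∀ {n} (f : Fin (suc n) → ℕ) → ∃ λ u → sum f ≤ suc n * f u
sum≤n*term {zero}  f = zero , ≤-refl
sum≤n*term {suc n} f with sum≤n*term (f ∘ suc)
... | u , ∑≤ with f zero ≤? f (suc u)
...   | yes f₀≤fᵤ = suc u , +-mono-≤ f₀≤fᵤ ∑≤
...   | no  f₀≰fᵤ = zero , +-monoʳ-≤ (f zero) (≤-trans ∑≤ (*-monoʳ-≤ (suc n) (<⇒≤ (≰⇒> f₀≰fᵤ))))

∣p∪⁅x⁆∣≤1+∣p∣ : ∀ {n} (p : Subset n) x → ∣ p ∪ ⁅ x ⁆ ∣ ≤ suc ∣ p ∣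
∣p∪⁅x⁆∣≤1+∣p∣ (outside ∷ p) zero    rewrite ∪-identityʳ p = ≤-refl
∣p∪⁅x⁆∣≤1+∣p∣ (inside  ∷ p) zero    rewrite ∪-identityʳ p = n≤1+n _
∣p∪⁅x⁆∣≤1+∣p∣ (outside ∷ p) (suc x) = ∣p∪⁅x⁆∣≤1+∣p∣ p x
∣p∪⁅x⁆∣≤1+∣p∣ (inside  ∷ p) (suc x) = s≤s (∣p∪⁅x⁆∣≤1+∣p∣ p x)

length-filter-tabulate : ∀ {A : Set} {n} (b : A → Bool) (f : Fin n → A) →
                         length (filter (T? ∘ b) (tabulate f)) ≡ ∑[ i < n ] indicator (b (f i))
length-filter-tabulate {n = zero}  b f = refl
length-filter-tabulate {n = suc n} b f with b (f zero)
... | true  = cong suc (length-filter-tabulate b (f ∘ suc))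
... | false = length-filter-tabulate b (f ∘ suc)

hopDeg≡∑ : ∀ {n} (G : Graph n) v → hopDeg G v ≡ ∑[ u < n ] indicator (dist2 G v u)
hopDeg≡∑ G v = length-filter-tabulate (dist2 G v) (λ u → u)

dist2-irrefl : ∀ {n} (G : Graph n) v → dist2 G v v ≡ false
dist2-irrefl G v with v Fin.≟ v
... | yes _   = refl
... | no v≢v = ⊥-elim (v≢v refl)

dist2-sym : ∀ {n} (G : Graph n) u v → dist2 G u v ≡ dist2 G v u
dist2-sym {n} G u v = cong₂ (λ a b → not a ∧ b) (⌊≟⌋-sym u v)
  (cong₂ (λ a b → not a ∧ b) (Graph.sym G u v) (cong or (map-cong common-sym (allFin n))))
  where
  ⌊≟⌋-sym : ∀ (u v : Fin n) → ⌊ u Fin.≟ v ⌋ ≡ ⌊ v Fin.≟ u ⌋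
  ⌊≟⌋-sym u v with u Fin.≟ v | v Fin.≟ u
  ... | yes _    | yes _    = refl
  ... | no _     | no _     = refl
  ... | yes refl | no u≢u   = ⊥-elim (u≢u refl)
  ... | no u≢v   | yes refl = ⊥-elim (u≢v refl)
  common-sym : ∀ k → (adj G u k ∧ adj G k v) ≡ (adj G v k ∧ adj G k u)
  common-sym k = trans (cong₂ _∧_ (Graph.sym G u k) (Graph.sym G k v)) (∧-comm (adj G k u) (adj G v k))

hopDeg<order : ∀ {n} (G : Graph n) v → hopDeg G v < n
hopDeg<order G v rewrite hopDeg≡∑ G v = ∑indicator<n (dist2 G v) v (dist2-irrefl G v)

CoveredBy : ∀ {n} → Graph n → Subset n → Fin n → Set
CoveredBy G S v = ∃ λ s → s ∈ S × T (dist2 G s v)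

module Covering {n} (G : Graph n) where

  covered? : ∀ S v → Dec (CoveredBy G S v)
  covered? S v = any? λ s → s ∈? S ×-dec T? (dist2 G s v)

  uncovered : Subset n → Fin n → Bool
  uncovered S v = not (does (covered? S v))

  #uncovered : Subset n → ℕ
  #uncovered S = ∑[ v < n ] indicator (uncovered S v)

  gain : Subset n → Fin n → ℕ
  gain S u = ∑[ v < n ] indicator (uncovered S v ∧ dist2 G u v)

  uncovered-false : ∀ {S v} → CoveredBy G S v → uncovered S v ≡ false
  uncovered-false {S} {v} covered = cong not (dec-true (covered? S v) covered)

  uncovered-true : ∀ {S v} → ¬ CoveredBy G S v → uncovered S v ≡ true
  uncovered-true {S} {v} ¬covered = cong not (dec-false (covered? S v) ¬covered)

  CoveredBy-∪ : ∀ {S v} u → CoveredBy G S v → CoveredBy G (S ∪ ⁅ u ⁆) v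
  CoveredBy-∪ u (s , s∈S , d) = s , p⊆p∪q ⁅ u ⁆ s∈S , d

  CoveredBy-⁅⁆ : ∀ {v} S u → T (dist2 G u v) → CoveredBy G (S ∪ ⁅ u ⁆) v
  CoveredBy-⁅⁆ S u d = u , q⊆p∪q S ⁅ u ⁆ (x∈⁅x⁆ u) , d

  #uncovered-⊥ : #uncovered ⊥ ≡ n
  #uncovered-⊥ = trans (sum-cong-≗ {n} λ v → cong indicator (uncovered-true λ { (_ , s∈⊥ , _) → ∉⊥ s∈⊥ })) (∑1≡n n)

  indicator-uncovered-∪⁅⁆ : ∀ S u v →
    indicator (uncovered (S ∪ ⁅ u ⁆) v) + indicator (uncovered S v ∧ dist2 G u v) ≤ indicator (uncovered S v)
  indicator-uncovered-∪⁅⁆ S u v with covered? S v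
  ... | yes covered rewrite uncovered-false (CoveredBy-∪ u covered) = z≤n
  ... | no _ with dist2 G u v in d
  ...   | true  rewrite uncovered-false (CoveredBy-⁅⁆ S u (subst T (sym d) tt)) = ≤-refl
  ...   | false = ≤-trans (≤-reflexive (+-identityʳ _)) (indicator≤1 _)

  #uncovered-∪⁅⁆ : ∀ S u → #uncovered (S ∪ ⁅ u ⁆) + gain S u ≤ #uncovered S
  #uncovered-∪⁅⁆ S u = begin
    #uncovered (S ∪ ⁅ u ⁆) + gain S u
      ≡⟨ ∑-distrib-+ (indicator ∘ uncovered (S ∪ ⁅ u ⁆)) (λ v → indicator (uncovered S v ∧ dist2 G u v)) ⟨
    ∑[ v < n ] (indicator (uncovered (S ∪ ⁅ u ⁆) v) + indicator (uncovered S v ∧ dist2 G u v))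
      ≤⟨ sum-mono-≤ (indicator-uncovered-∪⁅⁆ S u) ⟩
    #uncovered S ∎
    where open ≤-Reasoning

module Greedy {m} (G : Graph (suc m)) (δ : ℕ) (δ≤hopDeg : ∀ v → δ ≤ hopDeg G v) (1≤δ : 1 ≤ δ) where

  open Covering G

  n : ℕ
  n = suc m

  δ≤m : δ ≤ m
  δ≤m = ≤-pred (≤-<-trans (δ≤hopDeg zero) (hopDeg<order G zero))

  instance
    m≢0 : NonZero m
    m≢0 = >-nonZero (≤-trans 1≤δ δ≤m)

  coverer : ∀ v → ∃ λ u → T (dist2 G u v)
  coverer v with ∑indicator-witness (dist2 G v) (≤-trans 1≤δ (subst (δ ≤_) (hopDeg≡∑ G v) (δ≤hopDeg v)))
  ... | u , d = u , subst T (dist2-sym G v u) d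

  #uncovered*δ≤∑gain : ∀ S → #uncovered S * δ ≤ ∑[ u < n ] gain S u
  #uncovered*δ≤∑gain S = begin
    #uncovered S * δ                                     ≡⟨ *-distribʳ-sum δ (indicator ∘ uncovered S) ⟩
    ∑[ v < n ] (indicator (uncovered S v) * δ)          ≤⟨ sum-mono-≤ counted-δ-times ⟩
    ∑[ v < n ] ∑[ u < n ] indicator (uncovered S v ∧ dist2 G u v)
                                                         ≡⟨ ∑-comm (λ v u → indicator (uncovered S v ∧ dist2 G u v)) ⟩
    ∑[ u < n ] gain S u                                  ∎
    where
    open ≤-Reasoning
    counted-δ-times : ∀ v → indicator (uncovered S v) * δ ≤ ∑[ u < n ] indicator (uncovered S v ∧ dist2 G u v)
    counted-δ-times v with uncovered S v
    ... | false = z≤n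
    ... | true  = begin
      δ + 0                                 ≡⟨ +-identityʳ δ ⟩
      δ                                     ≤⟨ δ≤hopDeg v ⟩
      hopDeg G v                            ≡⟨ hopDeg≡∑ G v ⟩
      ∑[ u < n ] indicator (dist2 G v u)    ≡⟨ sum-cong-≗ {n} (cong indicator ∘ dist2-sym G v) ⟩
      ∑[ u < n ] indicator (dist2 G u v)    ∎

  greedy-step : ∀ S → ∃ λ u → Shrinks n δ (#uncovered S) (#uncovered (S ∪ ⁅ u ⁆))
  greedy-step S with sum≤n*term (gain S)
  ... | u , ∑gain≤n*gainᵤ = u , (begin
    #uncovered (S ∪ ⁅ u ⁆) * n + #uncovered S * δ    ≤⟨ +-monoʳ-≤ _ (≤-trans (#uncovered*δ≤∑gain S) ∑gain≤n*gainᵤ) ⟩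
    #uncovered (S ∪ ⁅ u ⁆) * n + n * gain S u        ≡⟨ cong (_+_ (#uncovered (S ∪ ⁅ u ⁆) * n)) (*-comm n (gain S u)) ⟩
    #uncovered (S ∪ ⁅ u ⁆) * n + gain S u * n        ≡⟨ *-distribʳ-+ n (#uncovered (S ∪ ⁅ u ⁆)) (gain S u) ⟨
    (#uncovered (S ∪ ⁅ u ⁆) + gain S u) * n          ≤⟨ *-monoˡ-≤ n (#uncovered-∪⁅⁆ S u) ⟩
    #uncovered S * n                                 ∎)
    where open ≤-Reasoning

  #uncovered-shrinks : ∀ {S v} u → ¬ CoveredBy G S v → T (dist2 G u v) → #uncovered (S ∪ ⁅ u ⁆) < #uncovered S
  #uncovered-shrinks {S} {v} u ¬covered d = begin-strict
    #uncovered (S ∪ ⁅ u ⁆)             <⟨ m<m+n _ (≤-trans (≤-reflexive (sym v-counted)) (term≤sum (λ w → indicator (uncovered S w ∧ dist2 G u w)) v)) ⟩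
    #uncovered (S ∪ ⁅ u ⁆) + gain S u  ≤⟨ #uncovered-∪⁅⁆ S u ⟩
    #uncovered S                       ∎
    where
    open ≤-Reasoning
    v-counted : indicator (uncovered S v ∧ dist2 G u v) ≡ 1
    v-counted rewrite uncovered-true ¬covered | Equivalence.to T-≡ d = refl

  complete : ∀ S → Acc _<_ (#uncovered S) →
             Σ (Subset n) λ S′ → TwoStepDominating G S′ × ∣ S′ ∣ ≤ ∣ S ∣ + #uncovered S
  complete S (acc smaller) with all? (covered? S)
  ... | yes dominating = S , dominating , m≤m+n ∣ S ∣ (#uncovered S)
  ... | no ¬dominating with ¬∀⟶∃¬ n (CoveredBy G S) (covered? S) ¬dominating
  ...   | v , ¬covered with coverer v
  ...     | u , u-covers-v with #uncovered-shrinks u ¬covered u-covers-v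
  ...       | fewer with complete (S ∪ ⁅ u ⁆) (smaller fewer)
  ...         | S′ , dominating , size = S′ , dominating , (begin
    ∣ S′ ∣                                         ≤⟨ size ⟩
    (∣ S ∪ ⁅ u ⁆ ∣) + #uncovered (S ∪ ⁅ u ⁆)      ≤⟨ +-monoˡ-≤ _ (∣p∪⁅x⁆∣≤1+∣p∣ S u) ⟩
    suc (∣ S ∣) + #uncovered (S ∪ ⁅ u ⁆)          ≡⟨ +-suc (∣ S ∣) _ ⟨
    (∣ S ∣) + suc (#uncovered (S ∪ ⁅ u ⁆))        ≤⟨ +-monoʳ-≤ (∣ S ∣) fewer ⟩
    (∣ S ∣) + #uncovered S                         ∎)
    where open ≤-Reasoning

  greedy : ∀ j S → Acc _<_ (#uncovered S) → ∣ S ∣ ≤ j → Decayed m δ j (#uncovered S) →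
           n ≤ #uncovered S * δ → Σ (Subset n) λ S′ → TwoStepDominating G S′ × SizeBound m δ ∣ S′ ∣
  greedy j S (acc smaller) size decayed many = step (greedy-step S)
    where
    step : (∃ λ u → Shrinks n δ (#uncovered S) (#uncovered (S ∪ ⁅ u ⁆))) →
           Σ (Subset n) λ S′ → TwoStepDominating G S′ × SizeBound m δ ∣ S′ ∣
    step (u , shrink) = continue (n ≤? c′ * δ)
      where
      c = #uncovered S
      c′ = #uncovered (S ∪ ⁅ u ⁆)
      size′ : ∣ S ∪ ⁅ u ⁆ ∣ ≤ suc j
      size′ = ≤-trans (∣p∪⁅x⁆∣≤1+∣p∣ S u) (s≤s size)
      continue : Dec (n ≤ c′ * δ) →
                 Σ (Subset n) λ S′ → TwoStepDominating G S′ × SizeBound m δ ∣ S′ ∣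
      continue (yes many′) = greedy (suc j) (S ∪ ⁅ u ⁆) (smaller (Shrinks⇒< {c = c} {c′} (≤-trans (s≤s z≤n) many) shrink))
                               size′ (Decayed-step {j = j} {c} {c′} (m≤n⇒m≤1+n δ≤m) decayed shrink) many′
      continue (no few) =
        let S′ , dominating , size″ = complete (S ∪ ⁅ u ⁆) (<-wellFounded _)
        in  S′ , dominating , SizeBound-at-stop {j = j} {c} {c′} δ≤m decayed many (≰⇒> few) shrink
                                (≤-trans size″ (+-monoˡ-≤ _ size′))

  twoStepDominatingSet : Σ (Subset n) λ S → TwoStepDominating G S × SizeBound m δ ∣ S ∣
  twoStepDominatingSet = greedy 0 ⊥ (<-wellFounded _) (≤-reflexive (∣⊥∣≡0 n))
    (subst (Decayed m δ 0) (sym #uncovered-⊥) (Decayed-initial m δ))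
    (subst (λ c → n ≤ c * δ) (sym #uncovered-⊥) (m≤m*n n δ {{>-nonZero 1≤δ}}))

^*!≢0 : ∀ n k .{{_ : NonZero n}} → NonZero (n ^ k * k !)
^*!≢0 n k = m*n≢0 (n ^ k) (k !) {{m^n≢0 n k}} {{k !≢0}}

/-mono-≤ : ∀ a b c d .{{_ : NonZero b}} .{{_ : NonZero d}} → a * d ≤ c * b →
           + a ℚᵘ./ b ℚᵘ.≤ + c ℚᵘ./ d
/-mono-≤ a (suc b) c (suc d) ad≤cb =
  *≤* (subst₂ ℤ._≤_ (ℤ.pos-* a (suc d)) (ℤ.pos-* c (suc b)) (ℤ.+≤+ ad≤cb))

/-cong : ∀ a b c d .{{_ : NonZero b}} .{{_ : NonZero d}} → a * d ≡ c * b →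
         + a ℚᵘ./ b ℚᵘ.≃ + c ℚᵘ./ d
/-cong a (suc b) c (suc d) ad≡cb =
  *≡* (subst₂ _≡_ (ℤ.pos-* a (suc d)) (ℤ.pos-* c (suc b)) (cong +_ ad≡cb))

/-*-/ : ∀ a b c d .{{_ : NonZero b}} .{{_ : NonZero d}} →
        (+ a ℚᵘ./ b) ℚᵘ.* (+ c ℚᵘ./ d) ℚᵘ.≃ (+ (a * c) ℚᵘ./ (b * d)) {{m*n≢0 b d}}
/-*-/ a (suc b) c (suc d) = ℚᵘ.≃-reflexive (cong (ℚᵘ._/ (suc b * suc d)) (sym (ℤ.pos-* a c)))

/-+-/ : ∀ a b c d .{{_ : NonZero b}} .{{_ : NonZero d}} →
        (+ a ℚᵘ./ b) ℚᵘ.+ (+ c ℚᵘ./ d) ℚᵘ.≃ (+ (a * d + c * b) ℚᵘ./ (b * d)) {{m*n≢0 b d}}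
/-+-/ a (suc b) c (suc d) = ℚᵘ.≃-reflexive (cong (ℚᵘ._/ (suc b * suc d))
  (sym (trans (ℤ.pos-+ (a * suc d) (c * suc b)) (cong₂ ℤ._+_ (ℤ.pos-* a (suc d)) (ℤ.pos-* c (suc b))))))

toℚᵘ-/ : ∀ i n → toℚᵘ (i ℚ./ suc n) ℚᵘ.≃ i ℚᵘ./ suc n
toℚᵘ-/ i n = ℚ.toℚᵘ-fromℚᵘ (i ℚᵘ./ suc n)

expTerm-≃ : ∀ p m k → toℚᵘ (expTerm (+ p ℚ./ suc m) k) ℚᵘ.≃ (+ (p ^ k) ℚᵘ./ (suc m ^ k * k !)) {{^*!≢0 (suc m) k}}
expTerm-≃ p m zero    = ℚᵘ.≃-refl
expTerm-≃ p m (suc k) = begin-equality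
  toℚᵘ (expTerm x k ℚ.* x ℚ.* (+ 1 ℚ./ suc k))
    ≃⟨ ℚ.toℚᵘ-homo-* (expTerm x k ℚ.* x) (+ 1 ℚ./ suc k) ⟩
  toℚᵘ (expTerm x k ℚ.* x) ℚᵘ.* toℚᵘ (+ 1 ℚ./ suc k)
    ≃⟨ ℚᵘ.*-cong (ℚ.toℚᵘ-homo-* (expTerm x k) x) (toℚᵘ-/ (+ 1) k) ⟩
  toℚᵘ (expTerm x k) ℚᵘ.* toℚᵘ x ℚᵘ.* (+ 1 ℚᵘ./ suc k)
    ≃⟨ ℚᵘ.*-congʳ (ℚᵘ.*-cong (expTerm-≃ p m k) (toℚᵘ-/ (+ p) m)) ⟩
  + (p ^ k) ℚᵘ./ (n ^ k * k !) ℚᵘ.* (+ p ℚᵘ./ n) ℚᵘ.* (+ 1 ℚᵘ./ suc k)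
    ≃⟨ ℚᵘ.*-congʳ (/-*-/ (p ^ k) (n ^ k * k !) p n) ⟩
  + (p ^ k * p) ℚᵘ./ (n ^ k * k ! * n) ℚᵘ.* (+ 1 ℚᵘ./ suc k)
    ≃⟨ /-*-/ (p ^ k * p) (n ^ k * k ! * n) 1 (suc k) ⟩
  + (p ^ k * p * 1) ℚᵘ./ (n ^ k * k ! * n * suc k)
    ≃⟨ /-cong _ _ _ _ (reorder (p ^ k) p (n ^ k) (k !) n (suc k)) ⟩
  + (p ^ suc k) ℚᵘ./ (n ^ suc k * suc k !) ∎
  where
  open ℚᵘ.≤-Reasoning
  n = suc m
  x = + p ℚ./ n
  instance
    _ = ^*!≢0 n k
    _ = ^*!≢0 n (suc k)
    _ = m*n≢0 (n ^ k * k !) n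
    _ = m*n≢0 (n ^ k * k ! * n) (suc k)
  reorder : ∀ P p N F n K → P * p * 1 * (n * N * (K * F)) ≡ p * P * (N * F * n * K)
  reorder = solve-∀

expTerm-≤ : ∀ p m k → toℚᵘ (expTerm (+ p ℚ./ suc m) k) ℚᵘ.≤
                     (+ multichoose p k ℚᵘ./ suc m ^ k) {{m^n≢0 (suc m) k}}
expTerm-≤ p m k = ℚᵘ.≤-respˡ-≃ (ℚᵘ.≃-sym (expTerm-≃ p m k)) (/-mono-≤ _ _ _ _ (begin
  p ^ k * n ^ k                    ≤⟨ *-monoˡ-≤ (n ^ k) (^≤!*multichoose p k) ⟩
  k ! * multichoose p k * n ^ k    ≡⟨ reorder (k !) (multichoose p k) (n ^ k) ⟩
  multichoose p k * (n ^ k * k !)  ∎))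
  where
  open ≤-Reasoning
  n = suc m
  instance
    _ = ^*!≢0 n k
    _ = m^n≢0 n k
  reorder : ∀ f a b → f * a * b ≡ a * (b * f)
  reorder = solve-∀

expPartial-≤ : ∀ p m N → toℚᵘ (expPartial (+ p ℚ./ suc m) N) ℚᵘ.≤
                        (+ multichooseSeries (suc m) p N ℚᵘ./ suc m ^ N) {{m^n≢0 (suc m) N}}
expPartial-≤ p m zero    = ℚᵘ.≤-refl
expPartial-≤ p m (suc N) = begin
  toℚᵘ (expPartial x N ℚ.+ expTerm x (suc N))
    ≃⟨ ℚ.toℚᵘ-homo-+ (expPartial x N) (expTerm x (suc N)) ⟩
  toℚᵘ (expPartial x N) ℚᵘ.+ toℚᵘ (expTerm x (suc N))
    ≤⟨ ℚᵘ.+-mono-≤ (expPartial-≤ p m N) (expTerm-≤ p m (suc N)) ⟩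
  + S ℚᵘ./ n ^ N ℚᵘ.+ + M ℚᵘ./ n ^ suc N
    ≃⟨ /-+-/ S (n ^ N) M (n ^ suc N) ⟩
  + (S * n ^ suc N + M * n ^ N) ℚᵘ./ (n ^ N * n ^ suc N)
    ≃⟨ /-cong _ _ _ _ (regroup S M n (n ^ N)) ⟩
  + (n * S + M) ℚᵘ./ n ^ suc N ∎
  where
  open ℚᵘ.≤-Reasoning
  n = suc m
  x = + p ℚ./ n
  S = multichooseSeries n p N
  M = multichoose p (suc N)
  instance
    _ = m^n≢0 n N
    _ = m^n≢0 n (suc N)
    _ = m*n≢0 (n ^ N) (n ^ suc N)
  regroup : ∀ S M n A → (S * (n * A) + M * A) * (n * A) ≡ (n * S + M) * (A * (n * A))
  regroup = solve-∀

expPartial≤δ : ∀ {m δ p} .{{_ : NonZero m}} → RatioPow≤ m p δ → ∀ N →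
               expPartial (+ p ℚ./ suc m) N ℚ.≤ + δ ℚ./ 1
expPartial≤δ {m} {δ} {p} ratio N = ℚ.toℚᵘ-cancel-≤ (begin
  toℚᵘ (expPartial (+ p ℚ./ n) N)    ≤⟨ expPartial-≤ p m N ⟩
  + S ℚᵘ./ n ^ N                      ≤⟨ /-mono-≤ S (n ^ N) δ 1 (≤-trans (≤-reflexive (*-identityʳ S)) (multichooseSeries≤δ*^ {δ = δ} ratio N)) ⟩
  + δ ℚᵘ./ 1                          ≃⟨ toℚᵘ-/ (+ δ) 0 ⟨
  toℚᵘ (+ δ ℚ./ 1)                    ∎)
  where
  open ℚᵘ.≤-Reasoning
  n = suc m
  S = multichooseSeries n p N
  instance
    _ = m^n≢0 n N

+[m+n]-+m≡+n : ∀ m n → + (m + n) - + m ≡ + n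
+[m+n]-+m≡+n m n = trans (ℤ.m-n≡m⊖n (m + n) m) (trans (ℤ.⊖-≥ (m≤m+n m n)) (cong +_ (m+n∸m≡n m n)))

/-nonPositive : ∀ {i} m → i ℤ.≤ ℤ.0ℤ → i ℚ./ suc m ℚ.≤ ℚ.0ℚ
/-nonPositive {i} m i≤0 = ℚ.toℚᵘ-cancel-≤
  (ℚᵘ.≤-respˡ-≃ (ℚᵘ.≃-sym (toℚᵘ-/ i m)) (*≤* (subst (ℤ._≤ ℤ.0ℤ) (sym (ℤ.*-identityʳ i)) i≤0)))

SizeBound⇒LeLn : ∀ {m δ s} .{{_ : NonZero m}} → SizeBound m δ s →
                 LeLn (frac (+ (s * δ) - + suc m) (suc m)) δ
SizeBound⇒LeLn {m} (inj₁ sδ≤n) = inj₁ (/-nonPositive m (ℤ.i≤j⇒i-j≤0 (ℤ.+≤+ sδ≤n)))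
SizeBound⇒LeLn {m} {δ} (inj₂ (p , sδ≡n+p , ratio)) = inj₂ λ N →
  subst (λ i → expPartial (i ℚ./ suc m) N ℚ.≤ + δ ℚ./ 1)
        (sym (trans (cong (λ k → + k - + suc m) sδ≡n+p) (+[m+n]-+m≡+n (suc m) p)))
        (expPartial≤δ {m} {δ} {p} ratio N)


mainTheorem7 : (n : ℕ) (G : Graph n) (δ : ℕ) → IsMinHopDeg G δ → 1 ≤ δ →
    Σ (Subset n) λ S → TwoStepDominating G S ×
    LeLn (frac (+ (∣ S ∣ * δ) - + n) n) δ
mainTheorem7 zero    G δ (_ , () , _) 1≤δ
mainTheorem7 (suc m) G δ (δ≤hopDeg , _) 1≤δ =
  let S , dominating , bound = twoStepDominatingSet in S , dominating , SizeBound⇒LeLn {m} {δ} {∣ S ∣} bound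
  where open Greedy G δ δ≤hopDeg 1≤δ
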